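{- If $\Gamma$ is a finite, incomplete, connected graph with property R, then every vertex of $\Gamma$ has valency strictly less than $4$.
   Context: For a set $P$ with a symmetric reflexive relation $\mathcal{C}$: a labelled heap is $(E,\le,\varepsilon)$ with $(E,\le)$ a finite poset, $\varepsilon:E\to P$, such that elements with $\varepsilon(a)\,\mathcal{C}\,\varepsilon(b)$ are comparable and $\le$ is the transitive closure of "$a\le b$ and $\varepsilon(a)\,\mathcal{C}\,\varepsilon(b)$"; heaps are label-preserving isomorphism classes, forming $H(P,\mathcal{C})$. $E(v)$ is the subheap on $E\setminus\{v\}$ (order: transitive closure of the same relation restricted). Trivial heap: trivial order. Convex chain: chain $x_1<\dots<x_t$ containing every $y$ with $x_i<y<x_j$; length $t$; balanced if $\varepsilon(x_1)=\varepsilon(x_t)$. Property P2: no balanced convex chain of length 2 or 3. $E(a)\prec^+E$ if $a$ is maximal in $E$ and some element maximal in $E(a)$ but not in $E$ has label $\ne\varepsilon(a)$; $\prec^-$ likewise with minimal elements; $\prec$ means either. Property P1: there is a (possibly trivial) sequence $E_1\prec\cdots\prec E$ with $E_1$ trivial. The concurrency graph of $H(P,\mathcal{C})$ has vertices $P$ and edges between distinct $v,w$ with $v\,\mathcal{C}\,w$. A graph has property R if it is the concurrency graph of a class of heaps in which every heap with property P2 has property P1. -}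

module Defs where

open import Level using (0ℓ)
open import Data.Bool using (Bool; true; false; T)
open import Data.Nat using (ℕ; zero; suc)
open import Data.Fin using (Fin; zero; suc; punchIn; fromℕ)
open import Data.Fin.Properties using (_≟_)
open import Data.List using (List; length; filter; allFin)
open import Data.Product using (_×_; Σ; ∃; ∃-syntax; _,_)
open import Data.Sum using (_⊎_)
open import Relation.Nullary using (¬_)
open import Relation.Nullary.Decidable using (T?)
open import Relation.Binary using (Rel; IsPartialOrder)
open import Relation.Binary.PropositionalEquality using (_≡_; _≢_)
open import Relation.Binary.Construct.Closure.Transitive using (TransClosure)
open import Relation.Binary.Construct.Closure.ReflexiveTransitive using (Star)
open import Function.Bundles using (_⇔_)

-- Heaps (isomorphism classes) are not formed explicitly: every property
-- used (P1, P2) is isomorphism invariant, so we work with representatives.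

module Heaps {P : Set} (C : Rel P 0ℓ) where

  record RawHeap (m : ℕ) : Set₁ where
    field
      ε   : Fin m → P
      _≤_ : Rel (Fin m) 0ℓ

  module _ {m : ℕ} (E : RawHeap m) where
    open RawHeap E

    Gen : Rel (Fin m) 0ℓ
    Gen a b = (a ≤ b) × C (ε a) (ε b)

    _<_ : Rel (Fin m) 0ℓ
    a < b = (a ≤ b) × (a ≢ b)

    IsLabelledHeap : Set
    IsLabelledHeap =
        IsPartialOrder _≡_ _≤_
      × (∀ a b → C (ε a) (ε b) → (a ≤ b) ⊎ (b ≤ a))
      × (∀ a b → (a ≤ b) ⇔ TransClosure Gen a b)

    Maximal : Fin m → Set
    Maximal a = ∀ b → a ≤ b → b ≡ a

    Minimal : Fin m → Set
    Minimal a = ∀ b → b ≤ a → b ≡ a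

    Trivial : Set
    Trivial = ∀ a b → a ≤ b → a ≡ b

    ConvexChain : (t : ℕ) → (Fin t → Fin m) → Set
    ConvexChain t x =
        (∀ i j → i Data.Fin.< j → x i < x j)
      × (∀ i j y → x i < y → y < x j → ∃[ k ] (y ≡ x k))

    Balanced : (t : ℕ) → (Fin (suc t) → Fin m) → Set
    Balanced t x = ε (x zero) ≡ ε (x (fromℕ t))

    P2 : Set
    P2 = (∀ (x : Fin 2 → Fin m) → ConvexChain 2 x → ¬ Balanced 1 x)
       × (∀ (x : Fin 3 → Fin m) → ConvexChain 3 x → ¬ Balanced 2 x)

  remove : {m : ℕ} → RawHeap (suc m) → Fin (suc m) → RawHeap m
  remove E v = record
    { ε   = λ a → RawHeap.ε E (punchIn v a)
    ; _≤_ = TransClosure (λ a b → Gen E (punchIn v a) (punchIn v b))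
    }

  StepPlus : {m : ℕ} → (E : RawHeap (suc m)) → Fin (suc m) → Set
  StepPlus E a =
      Maximal E a
    × ∃[ b ] ( Maximal (remove E a) b
             × ¬ Maximal E (punchIn a b)
             × RawHeap.ε E (punchIn a b) ≢ RawHeap.ε E a )

  StepMinus : {m : ℕ} → (E : RawHeap (suc m)) → Fin (suc m) → Set
  StepMinus E a =
      Minimal E a
    × ∃[ b ] ( Minimal (remove E a) b
             × ¬ Minimal E (punchIn a b)
             × RawHeap.ε E (punchIn a b) ≢ RawHeap.ε E a )

  Step : {m : ℕ} → (E : RawHeap (suc m)) → Fin (suc m) → Set
  Step E a = StepPlus E a ⊎ StepMinus E a

  data P1 : {m : ℕ} → RawHeap m → Set₁ where
    done : ∀ {m} {E : RawHeap m} → Trivial E → P1 E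
    step : ∀ {m} {E : RawHeap (suc m)} (a : Fin (suc m)) →
           Step E a → P1 (remove E a) → P1 E

record Graph (n : ℕ) : Set where
  field
    adj       : Fin n → Fin n → Bool
    adj-sym   : ∀ v w → adj v w ≡ adj w v
    adj-irrefl : ∀ v → adj v v ≡ false

module _ {n : ℕ} (Γ : Graph n) where
  open Graph Γ

  Adj : Rel (Fin n) 0ℓ
  Adj v w = T (adj v w)

  Connected : Set
  Connected = ∀ v w → Star Adj v w

  Incomplete : Set
  Incomplete = ∃[ v ] ∃[ w ] (v ≢ w × ¬ Adj v w)

  valency : Fin n → ℕ
  valency v = length (filter (λ w → T? (adj v w)) (allFin n))

  -- the relation C whose concurrency graph is Γ: equal or adjacent
  Conc : Rel (Fin n) 0ℓ
  Conc v w = (v ≡ w) ⊎ Adj v w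

  -- Property R: Γ is the concurrency graph of H(Fin n, Conc), and every
  -- heap in that class with property P2 has property P1
  PropertyR : Set₁
  PropertyR = ∀ {m} (E : Heaps.RawHeap Conc m) →
              Heaps.IsLabelledHeap Conc E → Heaps.P2 Conc E → Heaps.P1 Conc E

module Submission where

open import Defs
open import Data.Nat using (_<_)

open import Level using (0ℓ)
open import Data.Bool using (Bool; true; false; T)
open import Data.Bool.Properties using (T-≡; ¬-not) renaming (_≟_ to _≟ᵇ_)
open import Data.Empty using (⊥; ⊥-elim)
open import Data.Unit using (⊤; tt)
open import Data.Nat using (ℕ; zero; suc; s≤s; z≤n)
import Data.Nat as ℕ
open import Data.Nat.Properties using (≰⇒>)
open import Data.Fin using (Fin; zero; suc; punchIn; #_)
import Data.Fin as Fin
open import Data.Fin.Properties using (any?; all?; _≟_; <-cmp)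
open import Data.Product using (_×_; ∃-syntax; _,_; proj₁; proj₂)
open import Data.Product.Function.NonDependent.Propositional using (_×-⇔_)
open import Data.Sum using (_⊎_; inj₁; inj₂)
import Data.Sum as Sum
open import Data.Vec using (Vec; lookup; _∷_; [])
open import Data.List using (List; allFin; tabulate; filter; length; _∷_; [])
open import Data.List.Relation.Unary.All using (All; _∷_; [])
import Data.List.Relation.Unary.All.Properties as All
open import Data.List.Relation.Unary.AllPairs using (AllPairs; _∷_; [])
open import Data.List.Relation.Unary.Unique.Propositional using (Unique)
import Data.List.Relation.Unary.Unique.Propositional.Properties as Unique
open import Function.Base using (_∘_; id)
open import Function.Bundles using (_⇔_; mk⇔; Equivalence)
open Equivalence using (to; from)
import Function.Properties.Equivalence as ⇔
open import Function.Definitions using (Injective)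
open import Relation.Binary
  using (Rel; _=[_]⇒_; Reflexive; Symmetric; Decidable; DecidableEquality; tri<; tri≈; tri>)
open import Relation.Binary.PropositionalEquality
  using (_≡_; _≢_; refl; sym; trans; cong; subst; isEquivalence)
open import Relation.Binary.Construct.Closure.Transitive using (TransClosure; [_]; _∷_)
open import Relation.Binary.Construct.Closure.ReflexiveTransitive as Star using (Star; _◅_)
import Relation.Unary as U
open import Relation.Nullary using (¬_; Dec; yes; no)
open import Relation.Nullary.Decidable
  using (True; toWitness; T?; ¬?; _×-dec_; _⊎-dec_; _→-dec_)

-- Property R passes to induced subgraphs: a heap over a subgraph, relabelled into Γ, keeps
-- being a labelled heap with P2, and a P1-sequence of the relabelled heap pulls back.  The
-- claw K₁,₄, the diamond K₄ − e and the paw each fail R, witnessed by the heap of an explicit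
-- word that has P2 but is non-trivial and admits no step E(a) ≺ E.  Without induced paws and
-- diamonds, a neighbour of y that has a neighbour inside N(y) is adjacent to all of N(y); so
-- in a connected graph a triangle dominates, step by step along paths, every vertex, and the
-- graph is complete.  In a connected incomplete graph with R every neighbourhood is therefore
-- independent, and four neighbours of a vertex would span an induced claw.

transClosure-map : ∀ {A B : Set} {R : Rel A 0ℓ} {S : Rel B 0ℓ} {f : A → B} →
                   R =[ f ]⇒ S → TransClosure R =[ f ]⇒ TransClosure S
transClosure-map R⇒S [ r ]    = [ R⇒S r ]
transClosure-map R⇒S (r ∷ rs) = R⇒S r ∷ transClosure-map R⇒S rs

transClosure-⇔ : ∀ {A : Set} {R S : Rel A 0ℓ} → (∀ a b → R a b ⇔ S a b) →
                 ∀ {a b} → TransClosure R a b ⇔ TransClosure S a b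
transClosure-⇔ R⇔S = mk⇔ (transClosure-map (to (R⇔S _ _))) (transClosure-map (from (R⇔S _ _)))

allPairs-tabulate⁻ : ∀ {A : Set} {R : Rel A 0ℓ} {k} {f : Fin k → A} →
                     AllPairs R (tabulate f) → ∀ {i j} → i Fin.< j → R (f i) (f j)
allPairs-tabulate⁻ (first ∷ _) {zero}  {suc j} _         = All.tabulate⁻ first j
allPairs-tabulate⁻ (_ ∷ rest)  {suc i} {suc j} (s≤s i<j) = allPairs-tabulate⁻ rest i<j

module WordHeap {P : Set} {C : Rel P 0ℓ} (C-refl : Reflexive C) (C-sym : Symmetric C) where
  open Heaps C

  -- The heap of the word w: position i lies below position j when letters at increasing
  -- positions, consecutive ones C-related, lead from i to j.
  Below : ∀ {m} → (Fin m → P) → Rel (Fin m) 0ℓ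
  Below w zero    zero    = ⊤
  Below w zero    (suc j) = ∃[ k ] (C (w zero) (w (suc k)) × Below (w ∘ suc) k j)
  Below w (suc i) zero    = ⊥
  Below w (suc i) (suc j) = Below (w ∘ suc) i j

  wordHeap : ∀ {m} → (Fin m → P) → RawHeap m
  wordHeap w = record { ε = w ; _≤_ = Below w }

  below? : Decidable C → ∀ {m} (w : Fin m → P) → Decidable (Below w)
  below? C? w zero    zero    = yes tt
  below? C? w zero    (suc j) = any? λ k → C? (w zero) (w (suc k)) ×-dec below? C? (w ∘ suc) k j
  below? C? w (suc i) zero    = no λ ()
  below? C? w (suc i) (suc j) = below? C? (w ∘ suc) i j

  below-refl : ∀ {m} (w : Fin m → P) i → Below w i i
  below-refl w zero    = tt
  below-refl w (suc i) = below-refl (w ∘ suc) i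

  below-trans : ∀ {m} (w : Fin m → P) i j l → Below w i j → Below w j l → Below w i l
  below-trans w zero    zero    l       _            jl = jl
  below-trans w zero    (suc j) (suc l) (k , c , kj) jl = k , c , below-trans (w ∘ suc) k j l kj jl
  below-trans w (suc i) (suc j) (suc l) ij           jl = below-trans (w ∘ suc) i j l ij jl

  below-antisym : ∀ {m} (w : Fin m → P) i j → Below w i j → Below w j i → i ≡ j
  below-antisym w zero    zero    _  _  = refl
  below-antisym w (suc i) (suc j) ij ji = cong suc (below-antisym (w ∘ suc) i j ij ji)

  below-total : ∀ {m} (w : Fin m → P) i j → C (w i) (w j) → Below w i j ⊎ Below w j i
  below-total w zero    zero    _ = inj₁ tt
  below-total w zero    (suc j) c = inj₁ (j , c , below-refl (w ∘ suc) j)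
  below-total w (suc i) zero    c = inj₂ (i , C-sym c , below-refl (w ∘ suc) i)
  below-total w (suc i) (suc j) c = below-total (w ∘ suc) i j c

  below⇒gen⁺ : ∀ {m} (w : Fin m → P) {i j} → Below w i j → TransClosure (Gen (wordHeap w)) i j
  below⇒gen⁺ w {zero}  {zero}  _            = [ tt , C-refl ]
  below⇒gen⁺ w {zero}  {suc j} (k , c , kj) =
    ((k , c , below-refl (w ∘ suc) k) , c) ∷ transClosure-map id (below⇒gen⁺ (w ∘ suc) kj)
  below⇒gen⁺ w {suc i} {suc j} ij           = transClosure-map id (below⇒gen⁺ (w ∘ suc) ij)

  gen⁺⇒below : ∀ {m} (w : Fin m → P) {i j} → TransClosure (Gen (wordHeap w)) i j → Below w i j
  gen⁺⇒below w [ ij , _ ]                          = ij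
  gen⁺⇒below w {i} {l} (_∷_ {y = j} (ij , _) jl) = below-trans w i j l ij (gen⁺⇒below w jl)

  wordHeap-isLabelledHeap : ∀ {m} (w : Fin m → P) → IsLabelledHeap (wordHeap w)
  wordHeap-isLabelledHeap w =
      record
        { isPreorder = record
            { isEquivalence = isEquivalence
            ; reflexive     = λ { {i} refl → below-refl w i }
            ; trans         = λ {i} {j} {l} → below-trans w i j l }
        ; antisym = λ {i} {j} → below-antisym w i j }
    , below-total w
    , λ i j → mk⇔ (below⇒gen⁺ w) (gen⁺⇒below w)

module ChainObstruction {P : Set} (C : Rel P 0ℓ) {m : ℕ} (E : Heaps.RawHeap C m) where
  open Heaps C renaming (_<_ to _<ₕ_)
  open RawHeap E

  _≺_ : Rel (Fin m) 0ℓ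
  _≺_ = _<ₕ_ E

  PairsSeparated : Set
  PairsSeparated = ∀ p r → p ≺ r → ε p ≡ ε r → ∃[ y ] (p ≺ y × y ≺ r)

  TriplesSeparated : Set
  TriplesSeparated = ∀ p q r → p ≺ q → q ≺ r → ε p ≡ ε r → ∃[ y ] ((p ≺ y × y ≺ r) × y ≢ q)

  separated⇒P2 : PairsSeparated → TriplesSeparated → P2 E
  separated⇒P2 pairs triples = noPair , noTriple
    where
    noPair : ∀ x → ConvexChain E 2 x → ¬ Balanced E 1 x
    noPair x (chain , convex) balanced
      with pairs _ _ (chain zero (suc zero) (s≤s z≤n)) balanced
    ... | y , x₀≺y , y≺x₁ with convex zero (suc zero) y x₀≺y y≺x₁
    ... | zero     , refl = proj₂ x₀≺y refl
    ... | suc zero , refl = proj₂ y≺x₁ refl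
    noTriple : ∀ x → ConvexChain E 3 x → ¬ Balanced E 2 x
    noTriple x (chain , convex) balanced
      with triples _ _ _ (chain zero (suc zero) (s≤s z≤n))
                         (chain (suc zero) (suc (suc zero)) (s≤s (s≤s z≤n))) balanced
    ... | y , (x₀≺y , y≺x₂) , y≢x₁ with convex zero (suc (suc zero)) y x₀≺y y≺x₂
    ... | zero           , refl = proj₂ x₀≺y refl
    ... | suc zero       , refl = y≢x₁ refl
    ... | suc (suc zero) , refl = proj₂ y≺x₂ refl

  module _ (_≟ᴾ_ : DecidableEquality P) (_≤?_ : Decidable _≤_) where

    _≺?_ : Decidable _≺_
    a ≺? b = (a ≤? b) ×-dec ¬? (a ≟ b)

    pairsSeparated? : Dec PairsSeparated
    pairsSeparated? =
      all? λ p → all? λ r → (p ≺? r) →-dec (ε p ≟ᴾ ε r) →-dec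
      any? λ y → (p ≺? y) ×-dec (y ≺? r)

    triplesSeparated? : Dec TriplesSeparated
    triplesSeparated? =
      all? λ p → all? λ q → all? λ r → (p ≺? q) →-dec (q ≺? r) →-dec (ε p ≟ᴾ ε r) →-dec
      any? λ y → ((p ≺? y) ×-dec (y ≺? r)) ×-dec ¬? (y ≟ q)

module StepObstruction {P : Set} (C : Rel P 0ℓ) {m : ℕ} (E : Heaps.RawHeap C (suc m)) where
  open Heaps C
  open RawHeap E

  UpBlocked : Fin (suc m) → Fin m → Set
  UpBlocked a b =
    Maximal E (punchIn a b) ⊎ ε (punchIn a b) ≡ ε a ⊎ ∃[ c ] (c ≢ b × Gen E (punchIn a b) (punchIn a c))

  DownBlocked : Fin (suc m) → Fin m → Set
  DownBlocked a b =
    Minimal E (punchIn a b) ⊎ ε (punchIn a b) ≡ ε a ⊎ ∃[ c ] (c ≢ b × Gen E (punchIn a c) (punchIn a b))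

  Stuck : Set
  Stuck = ¬ Trivial E
        × (∀ a → Maximal E a → ∀ b → UpBlocked a b)
        × (∀ a → Minimal E a → ∀ b → DownBlocked a b)

  stuck⇒¬P1 : Stuck → ¬ P1 E
  stuck⇒¬P1 (nontrivial , _ , _) (done trivial) = nontrivial trivial
  stuck⇒¬P1 (_ , up , _) (step a (inj₁ (max-a , b , max-b , ¬max , ε≢)) _) with up a max-a b
  ... | inj₁ max                  = ¬max max
  ... | inj₂ (inj₁ ε≡)            = ε≢ ε≡
  ... | inj₂ (inj₂ (c , c≢b , g)) = c≢b (max-b c [ g ])
  stuck⇒¬P1 (_ , _ , down) (step a (inj₂ (min-a , b , min-b , ¬min , ε≢)) _) with down a min-a b
  ... | inj₁ min                  = ¬min min
  ... | inj₂ (inj₁ ε≡)            = ε≢ ε≡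
  ... | inj₂ (inj₂ (c , c≢b , g)) = c≢b (min-b c [ g ])

  module _ (C? : Decidable C) (_≟ᴾ_ : DecidableEquality P) (_≤?_ : Decidable _≤_) where

    maximal? : ∀ a → Dec (Maximal E a)
    maximal? a = all? λ b → (a ≤? b) →-dec (b ≟ a)

    minimal? : ∀ a → Dec (Minimal E a)
    minimal? a = all? λ b → (b ≤? a) →-dec (b ≟ a)

    gen? : Decidable (Gen E)
    gen? a b = (a ≤? b) ×-dec C? (ε a) (ε b)

    upBlocked? : ∀ a b → Dec (UpBlocked a b)
    upBlocked? a b = maximal? (punchIn a b) ⊎-dec (ε (punchIn a b) ≟ᴾ ε a) ⊎-dec
      any? λ c → ¬? (c ≟ b) ×-dec gen? (punchIn a b) (punchIn a c)

    downBlocked? : ∀ a b → Dec (DownBlocked a b)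
    downBlocked? a b = minimal? (punchIn a b) ⊎-dec (ε (punchIn a b) ≟ᴾ ε a) ⊎-dec
      any? λ c → ¬? (c ≟ b) ×-dec gen? (punchIn a c) (punchIn a b)

    stuck? : Dec Stuck
    stuck? = ¬? (all? λ a → all? λ b → (a ≤? b) →-dec (a ≟ b))
      ×-dec (all? λ a → maximal? a →-dec all? (upBlocked? a))
      ×-dec (all? λ a → minimal? a →-dec all? (downBlocked? a))

module Relabel {P Q : Set} {C : Rel P 0ℓ} {D : Rel Q 0ℓ}
               (g : P → Q) (g-conc : ∀ x y → D (g x) (g y) ⇔ C x y) where
  private
    module HC = Heaps C
    module HD = Heaps D
  open HC.RawHeap renaming (ε to εᶜ; _≤_ to ≤ᶜ)
  open HD.RawHeap renaming (ε to εᴰ; _≤_ to ≤ᴰ)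

  relabel : ∀ {m} → HC.RawHeap m → HD.RawHeap m
  relabel E = record { ε = g ∘ εᶜ E ; _≤_ = ≤ᶜ E }

  -- Orders agree only up to ⇔: removing a vertex recomputes the order as a transitive
  -- closure over D on one side and over C on the other.
  record Relabels {m} (E′ : HD.RawHeap m) (E : HC.RawHeap m) : Set where
    field
      label : ∀ a → εᴰ E′ a ≡ g (εᶜ E a)
      order : ∀ a b → ≤ᴰ E′ a b ⇔ ≤ᶜ E a b

  module _ {m} {E′ : HD.RawHeap m} {E : HC.RawHeap m} (rel : Relabels E′ E) where
    open Relabels rel

    gen⇔ : ∀ a b → HD.Gen E′ a b ⇔ HC.Gen E a b
    gen⇔ a b = order a b ×-⇔ conc
      where
      conc : D (εᴰ E′ a) (εᴰ E′ b) ⇔ C (εᶜ E a) (εᶜ E b)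
      conc rewrite label a | label b = g-conc (εᶜ E a) (εᶜ E b)

    labels-≡ : ∀ a b → εᶜ E a ≡ εᶜ E b → εᴰ E′ a ≡ εᴰ E′ b
    labels-≡ a b ε≡ = trans (label a) (trans (cong g ε≡) (sym (label b)))

    maximal⇔ : ∀ a → HD.Maximal E′ a ⇔ HC.Maximal E a
    maximal⇔ a = mk⇔ (λ max b → max b ∘ from (order a b)) (λ max b → max b ∘ to (order a b))

    minimal⇔ : ∀ a → HD.Minimal E′ a ⇔ HC.Minimal E a
    minimal⇔ a = mk⇔ (λ min b → min b ∘ from (order b a)) (λ min b → min b ∘ to (order b a))

  relabel-relabels : ∀ {m} (E : HC.RawHeap m) → Relabels (relabel E) E
  relabel-relabels E = record { label = λ _ → refl ; order = λ _ _ → mk⇔ id id }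

  remove-relabels : ∀ {m} {E′ : HD.RawHeap (suc m)} {E : HC.RawHeap (suc m)} →
                    Relabels E′ E → ∀ v → Relabels (HD.remove E′ v) (HC.remove E v)
  remove-relabels rel v = record
    { label = λ a → Relabels.label rel (punchIn v a)
    ; order = λ a b → transClosure-⇔ (λ a b → gen⇔ rel (punchIn v a) (punchIn v b)) }

  relabel-isLabelledHeap : ∀ {m} {E : HC.RawHeap m} → HC.IsLabelledHeap E → HD.IsLabelledHeap (relabel E)
  relabel-isLabelledHeap {E = E} (partialOrder , total , closure) =
      partialOrder
    , (λ a b → total a b ∘ to (g-conc _ _))
    , λ a b → ⇔.trans (closure a b) (transClosure-⇔ λ a b → ⇔.sym (gen⇔ (relabel-relabels E) a b))

  relabel-P2 : Injective _≡_ _≡_ g → ∀ {m} {E : HC.RawHeap m} → HC.P2 E → HD.P2 (relabel E)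
  relabel-P2 g-injective (noPair , noTriple) =
    (λ x chain → noPair x chain ∘ g-injective) , (λ x chain → noTriple x chain ∘ g-injective)

  step-unrelabel : ∀ {m} {E′ : HD.RawHeap (suc m)} {E : HC.RawHeap (suc m)} →
                   Relabels E′ E → ∀ v → HD.Step E′ v → HC.Step E v
  step-unrelabel rel v (inj₁ (max-v , b , max-b , ¬max , ε≢)) =
    inj₁ ( to (maximal⇔ rel v) max-v , b , to (maximal⇔ (remove-relabels rel v) b) max-b
         , ¬max ∘ from (maximal⇔ rel (punchIn v b)) , ε≢ ∘ labels-≡ rel (punchIn v b) v )
  step-unrelabel rel v (inj₂ (min-v , b , min-b , ¬min , ε≢)) =
    inj₂ ( to (minimal⇔ rel v) min-v , b , to (minimal⇔ (remove-relabels rel v) b) min-b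
         , ¬min ∘ from (minimal⇔ rel (punchIn v b)) , ε≢ ∘ labels-≡ rel (punchIn v b) v )

  P1-unrelabel : ∀ {m} {E′ : HD.RawHeap m} {E : HC.RawHeap m} → Relabels E′ E → HD.P1 E′ → HC.P1 E
  P1-unrelabel rel (HD.done trivial) = HC.done λ a b → trivial a b ∘ from (Relabels.order rel a b)
  P1-unrelabel rel (HD.step v st p1) =
    HC.step v (step-unrelabel rel v st) (P1-unrelabel (remove-relabels rel v) p1)

module _ {n} (Γ : Graph n) where
  open Graph Γ

  Adj-sym : ∀ {x y} → Adj Γ x y → Adj Γ y x
  Adj-sym {x} {y} = subst T (adj-sym x y)

  Adj⇒≢ : ∀ {x y} → Adj Γ x y → x ≢ y
  Adj⇒≢ {x} xx refl = subst T (adj-irrefl x) xx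

  edge : ∀ {x y} → Adj Γ x y → x ≢ y × adj x y ≡ true
  edge xy = Adj⇒≢ xy , to T-≡ xy

  non-edge : ∀ {x y} → x ≢ y → ¬ Adj Γ x y → x ≢ y × adj x y ≡ false
  non-edge x≢y ¬xy = x≢y , ¬-not (¬xy ∘ from T-≡)

  record Induced {k} (H : Graph k) : Set where
    field
      embed           : Fin k → Fin n
      embed-injective : Injective _≡_ _≡_ embed
      embed-adj       : ∀ i j → adj (embed i) (embed j) ≡ Graph.adj H i j

    conc-embed : ∀ i j → Conc Γ (embed i) (embed j) ⇔ Conc H i j
    conc-embed i j = mk⇔ (Sum.map embed-injective (subst T (embed-adj i j)))
                         (Sum.map (cong embed) (subst T (sym (embed-adj i j))))

  InducedPair : ∀ {k} → Graph k → (Fin k → Fin n) → Rel (Fin k) 0ℓ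
  InducedPair H f i j = f i ≢ f j × adj (f i) (f j) ≡ Graph.adj H i j

  induced : ∀ {k} {H : Graph k} (vs : Vec (Fin n) k) →
            AllPairs (InducedPair H (lookup vs)) (allFin k) → Induced H
  induced {H = H} vs pairs =
    record { embed = lookup vs ; embed-injective = injective ; embed-adj = adjacency }
    where
    pair : ∀ {i j} → i Fin.< j → InducedPair H (lookup vs) i j
    pair = allPairs-tabulate⁻ pairs
    injective : Injective _≡_ _≡_ (lookup vs)
    injective {i} {j} e with <-cmp i j
    ... | tri< i<j _ _ = ⊥-elim (proj₁ (pair i<j) e)
    ... | tri≈ _ i≡j _ = i≡j
    ... | tri> _ _ j<i = ⊥-elim (proj₁ (pair j<i) (sym e))
    adjacency : ∀ i j → adj (lookup vs i) (lookup vs j) ≡ Graph.adj H i j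
    adjacency i j with <-cmp i j
    ... | tri< i<j _ _  = proj₂ (pair i<j)
    ... | tri≈ _ refl _ = trans (adj-irrefl (lookup vs i)) (sym (Graph.adj-irrefl H i))
    ... | tri> _ _ j<i  = trans (adj-sym _ _) (trans (proj₂ (pair j<i)) (Graph.adj-sym H j i))

  PropertyR-induced : ∀ {k} {H : Graph k} → Induced H → PropertyR Γ → PropertyR H
  PropertyR-induced {H = H} ind R E heap p2 =
    P1-unrelabel (relabel-relabels E)
      (R (relabel E) (relabel-isLabelledHeap heap) (relabel-P2 embed-injective {E = E} p2))
    where
    open Induced ind
    open Relabel {C = Conc H} {D = Conc Γ} embed conc-embed

graph : ∀ {k} (adj : Fin k → Fin k → Bool) →
        {True (all? λ v → all? λ w → adj v w ≟ᵇ adj w v)} →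
        {True (all? λ v → adj v v ≟ᵇ false)} → Graph k
graph adj {sym} {irrefl} = record { adj = adj ; adj-sym = toWitness sym ; adj-irrefl = toWitness irrefl }

clawAdj : Fin 5 → Fin 5 → Bool
clawAdj zero    (suc _) = true
clawAdj (suc _) zero    = true
clawAdj _       _       = false

diamondAdj : Fin 4 → Fin 4 → Bool
diamondAdj zero          (suc _)       = true
diamondAdj (suc _)       zero          = true
diamondAdj (suc zero)    (suc (suc _)) = true
diamondAdj (suc (suc _)) (suc zero)    = true
diamondAdj _             _             = false

pawAdj : Fin 4 → Fin 4 → Bool
pawAdj zero                (suc _)             = true
pawAdj (suc _)             zero                = true
pawAdj (suc (suc zero))    (suc (suc (suc _))) = true
pawAdj (suc (suc (suc _))) (suc (suc zero))    = true
pawAdj _                   _                   = false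

claw : Graph 5
claw = graph clawAdj

diamond : Graph 4
diamond = graph diamondAdj

paw : Graph 4
paw = graph pawAdj

module _ {k} (H : Graph k) where
  open Graph H
  open Heaps (Conc H)

  conc? : Decidable (Conc H)
  conc? x y = (x ≟ y) ⊎-dec T? (adj x y)

  conc-sym : Symmetric (Conc H)
  conc-sym (inj₁ refl) = inj₁ refl
  conc-sym {x} {y} (inj₂ xy) rewrite adj-sym x y = inj₂ xy

  open WordHeap {C = Conc H} (inj₁ refl) conc-sym

  module _ {m} (w : Vec (Fin k) (suc m)) where
    private
      E : RawHeap (suc m)
      E = wordHeap (lookup w)
      _≤?_ : Decidable (RawHeap._≤_ E)
      _≤?_ = below? conc? (lookup w)
    open ChainObstruction (Conc H) E
    open StepObstruction (Conc H) E

    ¬PropertyR-by-word : True (pairsSeparated? _≟_ _≤?_) → True (triplesSeparated? _≟_ _≤?_) →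
                         True (stuck? conc? _≟_ _≤?_) → ¬ PropertyR H
    ¬PropertyR-by-word pairs triples stuck R =
      stuck⇒¬P1 (toWitness stuck)
        (R E (wordHeap-isLabelledHeap (lookup w)) (separated⇒P2 (toWitness pairs) (toWitness triples)))

¬PropertyR-claw : ¬ PropertyR claw
¬PropertyR-claw = ¬PropertyR-by-word claw (# 1 ∷ # 2 ∷ # 0 ∷ # 3 ∷ # 4 ∷ []) _ _ _

¬PropertyR-diamond : ¬ PropertyR diamond
¬PropertyR-diamond = ¬PropertyR-by-word diamond (# 2 ∷ # 3 ∷ # 0 ∷ # 1 ∷ # 2 ∷ # 3 ∷ []) _ _ _

¬PropertyR-paw : ¬ PropertyR paw
¬PropertyR-paw = ¬PropertyR-by-word paw (# 1 ∷ # 2 ∷ # 0 ∷ # 3 ∷ # 2 ∷ # 0 ∷ # 1 ∷ # 3 ∷ []) _ _ _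

module _ {n} {Γ : Graph n} (R : PropertyR Γ) where
  open Graph Γ

  nonisolated-universal : ∀ {y x w u} → Adj Γ y x → Adj Γ y w → Adj Γ y u → Adj Γ w u →
                          x ≢ w → Adj Γ x w
  nonisolated-universal {y} {x} {w} {u} yx yw yu wu x≢w with T? (adj x w) | T? (adj x u)
  ... | yes xw | _      = xw
  ... | no ¬xw | yes xu = ⊥-elim (¬PropertyR-diamond (PropertyR-induced Γ diamond-in-Γ R))
    where
    diamond-in-Γ : Induced Γ diamond
    diamond-in-Γ = induced Γ (y ∷ u ∷ x ∷ w ∷ [])
      ( (edge Γ yu ∷ edge Γ yx ∷ edge Γ yw ∷ [])
      ∷ (edge Γ (Adj-sym Γ xu) ∷ edge Γ (Adj-sym Γ wu) ∷ [])
      ∷ (non-edge Γ x≢w ¬xw ∷ [])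
      ∷ [] ∷ [])
  ... | no ¬xw | no ¬xu = ⊥-elim (¬PropertyR-paw (PropertyR-induced Γ paw-in-Γ R))
    where
    x≢u : x ≢ u
    x≢u refl = ¬xw (Adj-sym Γ wu)
    paw-in-Γ : Induced Γ paw
    paw-in-Γ = induced Γ (y ∷ x ∷ w ∷ u ∷ [])
      ( (edge Γ yx ∷ edge Γ yw ∷ edge Γ yu ∷ [])
      ∷ (non-edge Γ x≢w ¬xw ∷ non-edge Γ x≢u ¬xu ∷ [])
      ∷ (edge Γ wu ∷ [])
      ∷ [] ∷ [])

  Near : Fin n → Fin n → Set
  Near z t = z ≡ t ⊎ Adj Γ z t

  near-sym : ∀ {z t} → Near z t → Near t z
  near-sym (inj₁ z≡t) = inj₁ (sym z≡t)
  near-sym (inj₂ zt)  = inj₂ (Adj-sym Γ zt)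

  near⇒adj : ∀ {z t} → Near z t → z ≢ t → Adj Γ z t
  near⇒adj (inj₁ z≡t) z≢t = ⊥-elim (z≢t z≡t)
  near⇒adj (inj₂ zt)  _   = zt

  near-step : ∀ {z₁ z₂ t u} → Adj Γ z₁ z₂ → Near z₁ t → Near z₁ u → Adj Γ t u → z₁ ≢ u → Near z₂ t
  near-step z₁z₂ (inj₁ refl) _ _ _ = inj₂ (Adj-sym Γ z₁z₂)
  near-step {z₂ = z₂} {t} z₁z₂ (inj₂ z₁t) near-u tu z₁≢u with z₂ ≟ t
  ... | yes z₂≡t = inj₁ z₂≡t
  ... | no  z₂≢t = inj₂ (nonisolated-universal z₁z₂ z₁t (near⇒adj near-u z₁≢u) tu z₂≢t)

  module Triangle (connected : Connected Γ) {a b c} (ab : Adj Γ a b) (bc : Adj Γ b c) (ac : Adj Γ a c) where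

    record Dominated (z : Fin n) : Set where
      field
        near-a : Near z a
        near-b : Near z b
        near-c : Near z c
    open Dominated

    near-step₂ : ∀ {z₁ z₂ t u u′} → Adj Γ z₁ z₂ → Near z₁ t → Near z₁ u → Near z₁ u′ →
                 Adj Γ t u → Adj Γ t u′ → Adj Γ u u′ → Near z₂ t
    near-step₂ {z₁} {u = u} z₁z₂ nt nu nu′ tu tu′ uu′ with z₁ ≟ u
    ... | no  z₁≢u = near-step z₁z₂ nt nu tu z₁≢u
    ... | yes refl = near-step z₁z₂ nt nu′ tu′ (Adj⇒≢ Γ uu′)

    dominated-step : ∀ {z₁ z₂} → Adj Γ z₁ z₂ → Dominated z₁ → Dominated z₂
    dominated-step z₁z₂ d = record
      { near-a = near-step₂ z₁z₂ (near-a d) (near-b d) (near-c d) ab ac bc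
      ; near-b = near-step₂ z₁z₂ (near-b d) (near-a d) (near-c d) (Adj-sym Γ ab) bc ac
      ; near-c = near-step₂ z₁z₂ (near-c d) (near-a d) (near-b d) (Adj-sym Γ ac) (Adj-sym Γ bc) ab }

    dominated-along : ∀ {z₁ z₂} → Star (Adj Γ) z₁ z₂ → Dominated z₁ → Dominated z₂
    dominated-along Star.ε       d = d
    dominated-along (z₁z ◅ path) d = dominated-along path (dominated-step z₁z d)

    dominated : ∀ z → Dominated z
    dominated z = dominated-along (connected a z)
      (record { near-a = inj₁ refl ; near-b = inj₂ ab ; near-c = inj₂ ac })

    complete : ∀ {p q} → p ≢ q → Adj Γ p q
    complete {p} {q} p≢q with p ≟ a | p ≟ b | q ≟ a | q ≟ b
    ... | yes refl | _        | _        | _        = near⇒adj (near-sym (near-a (dominated q))) p≢q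
    ... | _        | yes refl | _        | _        = near⇒adj (near-sym (near-b (dominated q))) p≢q
    ... | _        | _        | yes refl | _        = near⇒adj (near-a (dominated p)) p≢q
    ... | _        | _        | _        | yes refl = near⇒adj (near-b (dominated p)) p≢q
    ... | no p≢a   | no _     | no q≢a   | no q≢b   =
      nonisolated-universal (Adj-sym Γ (near⇒adj (near-a (dominated p)) p≢a))
                            (Adj-sym Γ (near⇒adj (near-a (dominated q)) q≢a))
                            ab (near⇒adj (near-b (dominated q)) q≢b) p≢q

  triangle-free : Connected Γ → Incomplete Γ → ∀ {a b c} → Adj Γ a b → Adj Γ b c → Adj Γ a c → ⊥
  triangle-free connected (p , q , p≢q , ¬pq) ab bc ac = ¬pq (Triangle.complete connected ab bc ac p≢q)

  claw-from-neighbours : Connected Γ → Incomplete Γ → ∀ {v} xs → 4 ℕ.≤ length xs → Unique xs →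
                         All (Adj Γ v) xs → Induced Γ claw
  claw-from-neighbours connected incomplete {v} (a ∷ b ∷ c ∷ d ∷ _) _
          ((a≢b ∷ a≢c ∷ a≢d ∷ _) ∷ (b≢c ∷ b≢d ∷ _) ∷ (c≢d ∷ _) ∷ _) (va ∷ vb ∷ vc ∷ vd ∷ _) =
    induced Γ (v ∷ a ∷ b ∷ c ∷ d ∷ [])
      ( (edge Γ va ∷ edge Γ vb ∷ edge Γ vc ∷ edge Γ vd ∷ [])
      ∷ (leaves va vb a≢b ∷ leaves va vc a≢c ∷ leaves va vd a≢d ∷ [])
      ∷ (leaves vb vc b≢c ∷ leaves vb vd b≢d ∷ [])
      ∷ (leaves vc vd c≢d ∷ [])
      ∷ [] ∷ [])
    where
    leaves : ∀ {x y} → Adj Γ v x → Adj Γ v y → x ≢ y → x ≢ y × adj x y ≡ false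
    leaves vx vy x≢y = non-edge Γ x≢y λ xy → triangle-free connected incomplete vx xy vy
  claw-from-neighbours _ _ (_ ∷ _ ∷ _ ∷ []) (s≤s (s≤s (s≤s ()))) _ _
  claw-from-neighbours _ _ (_ ∷ _ ∷ [])     (s≤s (s≤s ()))       _ _
  claw-from-neighbours _ _ (_ ∷ [])         (s≤s ())             _ _
  claw-from-neighbours _ _ []               ()                   _ _

lemma3p3p7 : ∀ {n} (Γ : Graph n) → Connected Γ → Incomplete Γ → PropertyR Γ →
    ∀ v → valency Γ v < 4
lemma3p3p7 {n} Γ connected incomplete R v = ≰⇒> λ 4≤valency →
  ¬PropertyR-claw (PropertyR-induced Γ
    (claw-from-neighbours R connected incomplete neighbours 4≤valency neighbours-unique neighbours-adjacent) R)
  where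
  adjacent? : U.Decidable (Adj Γ v)
  adjacent? w = T? (Graph.adj Γ v w)
  neighbours : List (Fin n)
  neighbours = filter adjacent? (allFin n)
  neighbours-unique : Unique neighbours
  neighbours-unique = Unique.filter⁺ adjacent? (Unique.allFin⁺ n)
  neighbours-adjacent : All (Adj Γ v) neighbours
  neighbours-adjacent = All.all-filter adjacent? (allFin n)
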